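{- Let $G$ be a connected maximal nontraceable graph with distinct nonadjacent vertices $v_1,v_2$ such that $d(v_1)=d(v_2)=2$. (a) If $v_1$ and $v_2$ have exactly one common neighbour $x$, then $d(x)\ge 5$. (b) If $v_1$ and $v_2$ have the same two neighbours $x_1$ and $x_2$, then $N_G(x_1)\setminus\{x_2\}=N_G(x_2)\setminus\{x_1\}$ and $d(x_1)=d(x_2)\ge 5$.
   Context: Graphs are simple and finite. $N_G(v)$ is the open neighbourhood of $v$ and $d(v)$ its degree. A graph is traceable if it has a hamiltonian path. A graph $G$ is maximal nontraceable if $G$ is not traceable but $G+e$ is traceable for every pair of nonadjacent vertices joined by a new edge $e$. -}

module Defs where

open import Data.Nat using (ℕ)
open import Data.Bool using (Bool; true; false)
import Data.Bool as B
open import Data.Fin using (Fin)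
open import Data.List using (List; []; _∷_; last)
open import Data.Maybe using (just)
open import Data.List.Membership.Propositional using (_∈_)
open import Data.List.Relation.Unary.Unique.Propositional using (Unique)
open import Data.List.Relation.Unary.Linked using (Linked)
open import Data.Vec using (count; allFin)
open import Data.Product using (_×_; ∃)
open import Data.Sum using (_⊎_)
open import Relation.Binary.PropositionalEquality using (_≡_; _≢_)
open import Relation.Nullary using (¬_)

record Graph (n : ℕ) : Set where
  field
    adj    : Fin n → Fin n → Bool
    sym    : ∀ u v → adj u v ≡ adj v u
    irrefl : ∀ v → adj v v ≡ false
open Graph public

Adj : ∀ {n} → Graph n → Fin n → Fin n → Set
Adj G u v = adj G u v ≡ true

deg : ∀ {n} → Graph n → Fin n → ℕ
deg {n} G v = count (λ w → adj G v w B.≟ true) (allFin n)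

IsHamPath : ∀ {n} → (Fin n → Fin n → Set) → List (Fin n) → Set
IsHamPath {n} R p = Linked R p × Unique p × (∀ (v : Fin n) → v ∈ p)

TraceableRel : ∀ {n} → (Fin n → Fin n → Set) → Set
TraceableRel R = ∃ λ p → IsHamPath R p

Traceable : ∀ {n} → Graph n → Set
Traceable G = TraceableRel (Adj G)

AdjPlus : ∀ {n} → Graph n → Fin n → Fin n → Fin n → Fin n → Set
AdjPlus G u v a b = Adj G a b ⊎ ((a ≡ u × b ≡ v) ⊎ (a ≡ v × b ≡ u))

MaximalNontraceable : ∀ {n} → Graph n → Set
MaximalNontraceable {n} G =
  ¬ Traceable G ×
  (∀ (u v : Fin n) → u ≢ v → ¬ Adj G u v → TraceableRel (AdjPlus G u v))

Connected : ∀ {n} → Graph n → Set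
Connected {n} G = ∀ (u v : Fin n) → ∃ λ (w : List (Fin n)) →
  Linked (Adj G) (u ∷ w) × last (u ∷ w) ≡ just v

{-# OPTIONS --safe #-}
-- Since G is not traceable, for nonadjacent u ≠ v every hamiltonian path of G + uv uses the new
-- edge: it is a path of G ending at u followed by a path of G starting at v. Each claim is proved
-- by contradiction against such a path. The degree-two vertices and the assumed small
-- neighbourhoods leave only a few ways for the path to pass v₁, v₂ and their neighbours, and in
-- each of them a local rerouting yields a hamiltonian path of G. This shows that the two
-- neighbours of a degree-two vertex are adjacent; that in (a) the common neighbour x has a
-- neighbour outside {v₁, v₂, a, b}, where a and b are the other neighbours of v₁ and v₂; and that
-- in (b) every neighbour w ≠ x₂ of x₁ is adjacent to x₂ (reroute a path of G + wx₂), while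
-- N(x₁) ⊆ {x₂, v₁, v₂, y} is impossible. The degree bounds then follow by counting, and
-- d(x₁) = d(x₂) because the transposition (x₁ x₂) maps N(x₁) injectively into N(x₂).
module Submission where

open import Defs hiding (sym)
import Algebra.Solver.CommutativeMonoid as CommutativeMonoidSolver
open import Data.Bool using (true; false)
import Data.Bool as Bool
open import Data.Bool.Properties using (not-¬)
open import Data.Empty using (⊥; ⊥-elim)
open import Data.Fin using (Fin; zero; suc; _≟_)
open import Data.Fin.Permutation.Components using (transpose; transpose-inverse)
open import Data.Fin.Properties using (any?)
open import Data.List using (List; []; _∷_; _++_; [_]; _ʳ++_; reverse; length; filter)
import Data.List as List
open import Data.List.Membership.Propositional using (_∈_; _∉_)
open import Data.List.Membership.Propositional.Properties using (∈-∃++; ∈-++⁺ˡ; ∈-++⁺ʳ; ∈-++⁻; ∈-filter⁺; ∈-filter⁻; ∈-allFin)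
open import Data.List.Properties using (length-map; ʳ++-defn; reverse-involutive; ++-assoc; ∷ʳ-injectiveʳ; ∷-injectiveˡ)
open import Data.List.Relation.Binary.Permutation.Propositional using (_↭_; ↭-refl; ↭-sym; ↭-trans; prep; swap; ↭⇒↭ₛ)
open import Data.List.Relation.Binary.Permutation.Propositional.Properties using (shift; ↭-length; ↭-reverse; ++⁺ʳ; ++⁺ˡ; ∈-resp-↭; ++-commutativeMonoid)
import Data.List.Relation.Binary.Permutation.Setoid.Properties as ↭ₛ
open import Data.List.Relation.Binary.Subset.Propositional using (_⊆_)
open import Data.List.Relation.Unary.All as All using (All; []; _∷_)
open import Data.List.Relation.Unary.All.Properties using (++⁻ˡ; gmap⁺; ¬Any⇒All¬)
open import Data.List.Relation.Unary.Any using (here; there)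
open import Data.List.Relation.Unary.Linked as Linked using (Linked; []; [-]; _∷_)
open import Data.List.Relation.Unary.Unique.Propositional using (Unique; []; _∷_)
open import Data.List.Relation.Unary.Unique.Propositional.Properties using (allFin⁺; Unique[x∷xs]⇒x∉xs)
import Data.List.Relation.Unary.Unique.Propositional.Properties as Unique
open import Data.Nat using (ℕ; _≥_; zero; suc; _≤_; _≤?_; z≤n; s≤s)
open import Data.Nat.Properties using (≤-antisym; ≤-trans; ≰⇒>; 1+n≰n)
open import Data.Product using (_×_; _,_; ∃; ∃₂; proj₁; proj₂)
open import Data.Sum using (_⊎_; inj₁; inj₂; [_,_]′)
import Data.Sum
import Data.Vec as Vec
open import Function using (_∘_)
open import Function.Bundles using (_⇔_; mk⇔; Equivalence)
open import Level using (0ℓ)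
open import Relation.Binary.Core using (Rel)
open import Relation.Binary.Definitions using (_Respects_; Symmetric)
open import Relation.Binary.PropositionalEquality using (_≡_; _≢_; refl; sym; trans; cong; subst; setoid)
open import Relation.Nullary using (¬_; yes; no; does)
open import Relation.Nullary.Decidable using (_×-dec_; ¬?; decidable-stable)
open import Relation.Unary using (Pred; Decidable)

module ↭-Solver {A : Set} = CommutativeMonoidSolver (++-commutativeMonoid {A = A})
open ↭-Solver using (solve; _⊜_; _⊕_)

module _ {A : Set} where

  Unique-resp-↭ : Unique Respects _↭_
  Unique-resp-↭ σ = ↭ₛ.Unique-resp-↭ (setoid A) (↭⇒↭ₛ σ)

  Unique-++⁻ˡ : ∀ (xs : List A) {ys} → Unique (xs ++ ys) → Unique xs
  Unique-++⁻ˡ []       _              = []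
  Unique-++⁻ˡ (x ∷ xs) (x∉ ∷ xs++ys!) = ++⁻ˡ xs x∉ ∷ Unique-++⁻ˡ xs xs++ys!

  Unique-++⁻ʳ : ∀ (xs : List A) {ys} → Unique (xs ++ ys) → Unique ys
  Unique-++⁻ʳ []       ys!           = ys!
  Unique-++⁻ʳ (x ∷ xs) (_ ∷ xs++ys!) = Unique-++⁻ʳ xs xs++ys!

  Unique-++⇒∉ʳ : ∀ (xs : List A) {ys x} → Unique (xs ++ ys) → x ∈ xs → x ∉ ys
  Unique-++⇒∉ʳ (x ∷ xs) (x∉ ∷ _)      (here refl)  x∈ys = All.lookup x∉ (∈-++⁺ʳ xs x∈ys) refl
  Unique-++⇒∉ʳ (x ∷ xs) (_ ∷ xs++ys!) (there x∈xs)      = Unique-++⇒∉ʳ xs xs++ys! x∈xs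

  Unique-++-∷⇒∉ : ∀ (xs : List A) {x ys} → Unique (xs ++ x ∷ ys) → x ∉ ys
  Unique-++-∷⇒∉ xs u = Unique[x∷xs]⇒x∉xs (Unique-++⁻ʳ xs u)

  Unique-++-∷-∷⇒∉ : ∀ (xs : List A) {x y ys} → Unique (xs ++ x ∷ y ∷ ys) → y ∉ x ∷ xs × x ∉ y ∷ ys
  Unique-++-∷-∷⇒∉ xs {x} {y} {ys} xs++x∷y∷ys! =
    (λ y∈ → Unique-++⇒∉ʳ (x ∷ xs) split! y∈ (here refl)) , Unique-++⇒∉ʳ (x ∷ xs) split! (here refl)
    where
    split! : Unique ((x ∷ xs) ++ y ∷ ys)
    split! = Unique-resp-↭ (shift x xs (y ∷ ys)) xs++x∷y∷ys!

  length-mono-⊆ : ∀ {xs ys : List A} → Unique xs → xs ⊆ ys → length xs ≤ length ys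
  length-mono-⊆ {[]}     _            _       = z≤n
  length-mono-⊆ {x ∷ xs} (x∉xs ∷ xs!) x∷xs⊆ys with ∈-∃++ (x∷xs⊆ys (here refl))
  ... | ys₁ , ys₂ , refl = subst (suc (length xs) ≤_) (sym (↭-length (shift x ys₁ ys₂)))
                                 (s≤s (length-mono-⊆ xs! xs⊆ys₁++ys₂))
    where
    xs⊆ys₁++ys₂ : xs ⊆ ys₁ ++ ys₂
    xs⊆ys₁++ys₂ y∈xs with ∈-++⁻ ys₁ (x∷xs⊆ys (there y∈xs))
    ... | inj₁ y∈ys₁         = ∈-++⁺ˡ y∈ys₁
    ... | inj₂ (here refl)   = ⊥-elim (All.lookup x∉xs y∈xs refl)
    ... | inj₂ (there y∈ys₂) = ∈-++⁺ʳ ys₁ y∈ys₂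

  ʳ++↭++ : ∀ (xs ys : List A) → xs ʳ++ ys ↭ xs ++ ys
  ʳ++↭++ xs ys = subst (_↭ xs ++ ys) (sym (ʳ++-defn xs)) (++⁺ʳ ys (↭-reverse xs))

  reverse-ʳ++ : ∀ (xs : List A) {ys} → reverse xs ʳ++ ys ≡ xs ++ ys
  reverse-ʳ++ xs {ys} = trans (ʳ++-defn (reverse xs)) (cong (_++ ys) (reverse-involutive xs))

  other-of-pair : ∀ {xs : List A} {x} → Unique xs → length xs ≡ 2 → x ∈ xs →
                  ∃ λ y → y ≢ x × y ∈ xs × (∀ {z} → z ∈ xs → z ∈ x ∷ y ∷ [])
  other-of-pair ((p≢q ∷ []) ∷ _) refl (here refl) =
    _ , p≢q ∘ sym , there (here refl) , λ z∈ → z∈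
  other-of-pair ((p≢q ∷ []) ∷ _) refl (there (here refl)) =
    _ , p≢q , here refl , λ { (here e) → there (here e) ; (there (here e)) → here e }

  data Position (c v : A) (T : List A) : Set where
    alone : T ≡ [ v ] → Position c v T
    first : ∀ T′ → T ≡ v ∷ c ∷ T′ → Position c v T
    last  : ∀ T′ → T ≡ T′ ++ c ∷ v ∷ [] → Position c v T

  ++-∷-∷-injectiveʳ : ∀ {a b c d : A} T₁ T₂ → T₁ ++ a ∷ b ∷ [] ≡ T₂ ++ c ∷ d ∷ [] → b ≡ d
  ++-∷-∷-injectiveʳ {a} {b} {c} {d} T₁ T₂ e = ∷ʳ-injectiveʳ (T₁ ++ [ a ]) (T₂ ++ [ c ])
    (trans (++-assoc T₁ [ a ] [ b ]) (trans e (sym (++-assoc T₂ [ c ] [ d ]))))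

  private
    [-]≢++-∷-∷ : ∀ {x a b : A} T → x ∷ [] ≢ T ++ a ∷ b ∷ []
    [-]≢++-∷-∷ []          ()
    [-]≢++-∷-∷ (_ ∷ [])    ()
    [-]≢++-∷-∷ (_ ∷ _ ∷ _) ()

    first≡last : ∀ {v c v′ : A} T₁ T₂ → Unique (v ∷ c ∷ T₁) →
                 v ∷ c ∷ T₁ ≡ T₂ ++ c ∷ v′ ∷ [] → T₁ ≡ [ v′ ]
    first≡last _ []           ((c≢c ∷ _) ∷ _) refl = ⊥-elim (c≢c refl)
    first≡last _ (_ ∷ [])     _               refl = refl
    first≡last _ (_ ∷ _ ∷ T₃) (_ ∷ c∉ ∷ _)    refl = ⊥-elim (All.lookup c∉ (∈-++⁺ʳ T₃ (here refl)) refl)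

  Position-pair : ∀ {c v v′ : A} {T} → Unique T → v ≢ v′ → Position c v T → Position c v′ T →
                  T ≡ v ∷ c ∷ v′ ∷ [] ⊎ T ≡ v′ ∷ c ∷ v ∷ []
  Position-pair _ v≢v′ (alone e)    (alone e′)    = ⊥-elim (v≢v′ (∷-injectiveˡ (trans (sym e) e′)))
  Position-pair _ _    (alone e)    (first _ e′)  with trans (sym e) e′
  ... | ()
  Position-pair _ _    (alone e)    (last T e′)   = ⊥-elim ([-]≢++-∷-∷ T (trans (sym e) e′))
  Position-pair _ _    (first _ e)  (alone e′)    with trans (sym e) e′
  ... | ()
  Position-pair _ v≢v′ (first _ e)  (first _ e′)  = ⊥-elim (v≢v′ (∷-injectiveˡ (trans (sym e) e′)))
  Position-pair T! _   (first T₁ refl) (last T₂ e′) =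
    inj₁ (cong (λ T′ → _ ∷ _ ∷ T′) (first≡last T₁ T₂ T! e′))
  Position-pair _ _    (last T e)   (alone e′)    = ⊥-elim ([-]≢++-∷-∷ T (trans (sym e′) e))
  Position-pair T! _   (last T₂ e)  (first T₁ refl) =
    inj₂ (cong (λ T′ → _ ∷ _ ∷ T′) (first≡last T₁ T₂ T! e))
  Position-pair _ v≢v′ (last T₁ e)  (last T₂ e′)  =
    ⊥-elim (v≢v′ (++-∷-∷-injectiveʳ T₁ T₂ (trans (sym e) e′)))

module _ {A : Set} {R : Rel A 0ℓ} where

  Linked-++⁻ˡ : ∀ xs {ys} → Linked R (xs ++ ys) → Linked R xs
  Linked-++⁻ˡ []           _        = []
  Linked-++⁻ˡ (x ∷ [])     _        = [-]
  Linked-++⁻ˡ (x ∷ y ∷ xs) (r ∷ rs) = r ∷ Linked-++⁻ˡ (y ∷ xs) rs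

  Linked-graft : ∀ xs {a ys zs} → Linked R (xs ++ a ∷ ys) → Linked R (a ∷ zs) → Linked R (xs ++ a ∷ zs)
  Linked-graft []           _        rs′ = rs′
  Linked-graft (x ∷ [])     (r ∷ _)  rs′ = r ∷ rs′
  Linked-graft (x ∷ y ∷ xs) (r ∷ rs) rs′ = r ∷ Linked-graft (y ∷ xs) rs rs′

  module _ (R-sym : Symmetric R) where

    Linked-ʳ++⁻ : ∀ xs {a ys} → Linked R (xs ʳ++ a ∷ ys) → Linked R (a ∷ xs) × Linked R (a ∷ ys)
    Linked-ʳ++⁻ []       rs = [-] , rs
    Linked-ʳ++⁻ (x ∷ xs) rs with Linked-ʳ++⁻ xs rs
    ... | rs₁ , r ∷ rs₂ = R-sym r ∷ rs₁ , rs₂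

    Linked-ʳ++⁺ : ∀ xs {a ys} → Linked R (a ∷ xs) → Linked R (a ∷ ys) → Linked R (xs ʳ++ a ∷ ys)
    Linked-ʳ++⁺ []       _         rs₂ = rs₂
    Linked-ʳ++⁺ (x ∷ xs) (r ∷ rs₁) rs₂ = Linked-ʳ++⁺ xs rs₁ (R-sym r ∷ rs₂)

    pendant-last : ∀ {h v c} T → Linked R (h ∷ T) → Unique (h ∷ T) → v ∈ T →
                   (∀ {w} → R v w → w ∈ h ∷ T → w ≡ c) →
                   (∃ λ T′ → T ≡ T′ ++ c ∷ v ∷ []) ⊎ (T ≡ [ v ] × h ≡ c)
    pendant-last (t ∷ []) (r ∷ _) _ (here refl) N⊆ = inj₂ (refl , N⊆ (R-sym r) (here refl))
    pendant-last {h} (t ∷ t′ ∷ T) (r ∷ r′ ∷ _) (h∉ ∷ _) (here refl) N⊆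
      with N⊆ r′ (there (there (here refl))) | N⊆ (R-sym r) (here refl)
    ... | refl | refl = ⊥-elim (All.lookup h∉ (there (here refl)) refl)
    pendant-last (t ∷ T) (_ ∷ rs) (_ ∷ t∷T!) (there v∈T) N⊆
      with pendant-last T rs t∷T! v∈T (λ r → N⊆ r ∘ there)
    ... | inj₁ (T′ , refl)   = inj₁ (t ∷ T′ , refl)
    ... | inj₂ (refl , refl) = inj₁ ([] , refl)

    pendant-of-head : ∀ {h v} T → Linked R (h ∷ T) → Unique (h ∷ T) → v ∈ T →
                      (∀ {w} → R v w → w ∈ h ∷ T → w ≡ h) → T ≡ [ v ]
    pendant-of-head {h} T rs (h∉T ∷ T!) v∈T N⊆ with pendant-last T rs (h∉T ∷ T!) v∈T N⊆
    ... | inj₁ (T′ , refl)  = ⊥-elim (All.lookup h∉T (∈-++⁺ʳ T′ (here refl)) refl)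
    ... | inj₂ (T≡[v] , _) = T≡[v]

    position : ∀ {h v c} T → Linked R (h ∷ T) → Unique (h ∷ T) → v ∈ T →
               (∀ {w} → R v w → w ∈ h ∷ T → w ∈ h ∷ c ∷ []) → Position c v T
    position (t ∷ []) _ _ (here refl) _ = alone refl
    position (t ∷ t′ ∷ T) (_ ∷ r ∷ _) (h∉ ∷ _) (here refl) N⊆ with N⊆ r (there (there (here refl)))
    ... | here refl         = ⊥-elim (All.lookup h∉ (there (here refl)) refl)
    ... | there (here refl) = first T refl
    position {h} {v} {c} (t ∷ T) (_ ∷ rs) (h∉ ∷ t∷T!) (there v∈T) N⊆
      with pendant-last T rs t∷T! v∈T N⊆c
      where
      N⊆c : ∀ {w} → R v w → w ∈ t ∷ T → w ≡ c
      N⊆c r w∈ with N⊆ r (there w∈)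
      ... | here refl         = ⊥-elim (All.lookup h∉ w∈ refl)
      ... | there (here w≡c) = w≡c
    ... | inj₁ (T′ , refl)   = last (t ∷ T′) refl
    ... | inj₂ (refl , refl) = last [] refl

module _ {A : Set} {P : Pred A 0ℓ} (P? : Decidable P) where

  count≡length∘filter : ∀ {m} (xs : Vec.Vec A m) →
                        Vec.count P? xs ≡ length (filter P? (Vec.toList xs))
  count≡length∘filter Vec.[] = refl
  count≡length∘filter (x Vec.∷ xs) with does (P? x)
  ... | true  = cong suc (count≡length∘filter xs)
  ... | false = count≡length∘filter xs

toList-tabulate : ∀ {A : Set} {m} (f : Fin m → A) → Vec.toList (Vec.tabulate f) ≡ List.tabulate f
toList-tabulate {m = zero}  f = refl
toList-tabulate {m = suc m} f = cong (f zero ∷_) (toList-tabulate (f ∘ suc))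

module Neighbourhoods {n : ℕ} (G : Graph n) where

  open import Data.List.Membership.DecPropositional (_≟_ {n}) using (_∈?_)

  Adj-sym : ∀ {u v} → Adj G u v → Adj G v u
  Adj-sym {u} {v} uv = trans (Graph.sym G v u) uv

  Adj⇒≢ : ∀ {u v} → Adj G u v → u ≢ v
  Adj⇒≢ {u} uu refl with trans (sym uu) (irrefl G u)
  ... | ()

  N[_]⊆_ : Fin n → List (Fin n) → Set
  N[ v ]⊆ us = ∀ {w} → Adj G v w → w ∈ us

  adjacent? : ∀ v → Decidable (Adj G v)
  adjacent? v w = adj G v w Bool.≟ true

  neighbours : Fin n → List (Fin n)
  neighbours v = filter (adjacent? v) (List.allFin n)

  deg≡length-neighbours : ∀ v → deg G v ≡ length (neighbours v)
  deg≡length-neighbours v = trans (count≡length∘filter (adjacent? v) (Vec.allFin n))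
                                  (cong (length ∘ filter (adjacent? v)) (toList-tabulate (λ w → w)))

  neighbours-unique : ∀ v → Unique (neighbours v)
  neighbours-unique v = Unique.filter⁺ (adjacent? v) (allFin⁺ n)

  ∈-neighbours⁺ : ∀ {v w} → Adj G v w → w ∈ neighbours v
  ∈-neighbours⁺ {v} {w} vw = ∈-filter⁺ (adjacent? v) (∈-allFin w) vw

  ∈-neighbours⁻ : ∀ {v w} → w ∈ neighbours v → Adj G v w
  ∈-neighbours⁻ {v} w∈ = proj₂ (∈-filter⁻ (adjacent? v) {xs = List.allFin n} w∈)

  length≤deg : ∀ {v} {us : List (Fin n)} → Unique us → All (Adj G v) us → length us ≤ deg G v
  length≤deg {v} us! vus = subst (_ ≤_) (sym (deg≡length-neighbours v))
    (length-mono-⊆ us! (∈-neighbours⁺ ∘ All.lookup vus))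

  deg-mono : ∀ {x y} (f : Fin n → Fin n) → (∀ {i j} → f i ≡ f j → i ≡ j) →
             (∀ {w} → Adj G x w → Adj G y (f w)) → deg G x ≤ deg G y
  deg-mono {x} f f-inj xy =
    subst (_≤ _) (trans (length-map f (neighbours x)) (sym (deg≡length-neighbours x)))
    (length≤deg (Unique.map⁺ f-inj (neighbours-unique x))
                (gmap⁺ xy (All.tabulate ∈-neighbours⁻)))

  other-neighbour : ∀ {v x} → deg G v ≡ 2 → Adj G v x →
                    ∃ λ a → a ≢ x × Adj G v a × N[ v ]⊆ (x ∷ a ∷ [])
  other-neighbour {v} d vx
    with other-of-pair (neighbours-unique v) (trans (sym (deg≡length-neighbours v)) d) (∈-neighbours⁺ vx)
  ... | a , a≢x , a∈ , N⊆ = a , a≢x , ∈-neighbours⁻ a∈ , N⊆ ∘ ∈-neighbours⁺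

  neighbour-outside? : ∀ v us → N[ v ]⊆ us ⊎ ∃ λ w → Adj G v w × w ∉ us
  neighbour-outside? v us with any? (λ w → adjacent? v w ×-dec ¬? (w ∈? us))
  ... | yes (w , vw , w∉us) = inj₂ (w , vw , w∉us)
  ... | no ∄w = inj₁ λ {w} vw → decidable-stable (w ∈? us) (λ w∉us → ∄w (w , vw , w∉us))

  deg≤length⇒N⊆ : ∀ {v us} → Unique us → All (Adj G v) us → deg G v ≤ length us → N[ v ]⊆ us
  deg≤length⇒N⊆ {v} {us} us! vus deg≤ with neighbour-outside? v us
  ... | inj₁ N⊆us            = N⊆us
  ... | inj₂ (w , vw , w∉us) =
    ⊥-elim (1+n≰n (≤-trans (length≤deg (¬Any⇒All¬ us w∉us ∷ us!) (vw ∷ vus)) deg≤))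

  deg≤1+length⇒N⊆∷ : ∀ {v us} → Unique us → All (Adj G v) us → deg G v ≤ suc (length us) →
                     ∃ λ y → N[ v ]⊆ (y ∷ us)
  deg≤1+length⇒N⊆∷ {v} {us} us! vus deg≤ with neighbour-outside? v us
  ... | inj₁ N⊆us            = v , there ∘ N⊆us
  ... | inj₂ (w , vw , w∉us) = w , deg≤length⇒N⊆ (¬Any⇒All¬ us w∉us ∷ us!) (vw ∷ vus) deg≤

  deg≤-of-twin : ∀ {x₁ x₂} → Adj G x₁ x₂ → (∀ {w} → Adj G x₁ w → w ≢ x₂ → Adj G x₂ w) →
                 deg G x₁ ≤ deg G x₂
  deg≤-of-twin {x₁} {x₂} x₁x₂ N⊆ = deg-mono (transpose x₁ x₂) transpose-injective into
    where
    transpose-injective : ∀ {i j} → transpose x₁ x₂ i ≡ transpose x₁ x₂ j → i ≡ j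
    transpose-injective {i} {j} e =
      trans (sym (transpose-inverse x₂ x₁)) (trans (cong (transpose x₂ x₁) e) (transpose-inverse x₂ x₁))
    into : ∀ {w} → Adj G x₁ w → Adj G x₂ (transpose x₁ x₂ w)
    into {w} x₁w with w ≟ x₁
    ... | yes refl = ⊥-elim (Adj⇒≢ x₁w refl)
    ... | no _ with w ≟ x₂
    ...   | yes refl = Adj-sym x₁x₂
    ...   | no w≢x₂  = N⊆ x₁w w≢x₂

  record OneCommonNeighbour (x v₁ a v₂ b : Fin n) : Set where
    field
      v₁x   : Adj G v₁ x
      v₁a   : Adj G v₁ a
      v₂x   : Adj G v₂ x
      v₂b   : Adj G v₂ b
      N-v₁  : N[ v₁ ]⊆ (x ∷ a ∷ [])
      N-v₂  : N[ v₂ ]⊆ (x ∷ b ∷ [])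
      a≢x   : a ≢ x
      b≢x   : b ≢ x
      a≢b   : a ≢ b
      v₁≢v₂ : v₁ ≢ v₂
      ¬v₁v₂ : ¬ Adj G v₁ v₂

  OneCommonNeighbour-sym : ∀ {x v₁ a v₂ b} →
                           OneCommonNeighbour x v₁ a v₂ b → OneCommonNeighbour x v₂ b v₁ a
  OneCommonNeighbour-sym c = record
    { v₁x = v₂x ; v₁a = v₂b ; v₂x = v₁x ; v₂b = v₁a ; N-v₁ = N-v₂ ; N-v₂ = N-v₁
    ; a≢x = b≢x ; b≢x = a≢x ; a≢b = a≢b ∘ sym ; v₁≢v₂ = v₁≢v₂ ∘ sym ; ¬v₁v₂ = ¬v₁v₂ ∘ Adj-sym }
    where open OneCommonNeighbour c

  one-common-neighbour : ∀ {x v₁ v₂} → deg G v₁ ≡ 2 → deg G v₂ ≡ 2 → v₁ ≢ v₂ → ¬ Adj G v₁ v₂ →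
                         (∀ w → (Adj G v₁ w × Adj G v₂ w) ⇔ (w ≡ x)) →
                         ∃₂ λ a b → OneCommonNeighbour x v₁ a v₂ b
  one-common-neighbour {x} {v₁} {v₂} deg-v₁ deg-v₂ v₁≢v₂ ¬v₁v₂ common
    with Equivalence.from (common x) refl
  ... | v₁x , v₂x with other-neighbour deg-v₁ v₁x | other-neighbour deg-v₂ v₂x
  ...   | a , a≢x , v₁a , N-v₁ | b , b≢x , v₂b , N-v₂ = a , b , record
    { v₁x = v₁x ; v₁a = v₁a ; v₂x = v₂x ; v₂b = v₂b ; N-v₁ = N-v₁ ; N-v₂ = N-v₂
    ; a≢x = a≢x ; b≢x = b≢x ; v₁≢v₂ = v₁≢v₂ ; ¬v₁v₂ = ¬v₁v₂
    ; a≢b = λ a≡b → a≢x (Equivalence.to (common a) (v₁a , subst (Adj G v₂) (sym a≡b) v₂b)) }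

  N[_]≡[_,_] : Fin n → Fin n → Fin n → Set
  N[ v ]≡[ p , q ] = Adj G v p × Adj G v q × N[ v ]⊆ (p ∷ q ∷ [])

  record TwoCommonNeighbours (x₁ x₂ v₁ v₂ : Fin n) : Set where
    field
      v₁x₁  : Adj G v₁ x₁
      v₁x₂  : Adj G v₁ x₂
      v₂x₁  : Adj G v₂ x₁
      v₂x₂  : Adj G v₂ x₂
      N-v₁  : N[ v₁ ]⊆ (x₁ ∷ x₂ ∷ [])
      N-v₂  : N[ v₂ ]⊆ (x₁ ∷ x₂ ∷ [])
      x₁≢x₂ : x₁ ≢ x₂
      v₁≢v₂ : v₁ ≢ v₂
      ¬v₁v₂ : ¬ Adj G v₁ v₂

    N-v₁≡ : N[ v₁ ]≡[ x₁ , x₂ ]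
    N-v₁≡ = v₁x₁ , v₁x₂ , N-v₁

    N-v₂≡ : N[ v₂ ]≡[ x₁ , x₂ ]
    N-v₂≡ = v₂x₁ , v₂x₂ , N-v₂

  two-common-neighbours : ∀ {x₁ x₂ v₁ v₂} → x₁ ≢ x₂ → v₁ ≢ v₂ → ¬ Adj G v₁ v₂ →
                          (∀ w → Adj G v₁ w ⇔ (w ≡ x₁ ⊎ w ≡ x₂)) →
                          (∀ w → Adj G v₂ w ⇔ (w ≡ x₁ ⊎ w ≡ x₂)) →
                          TwoCommonNeighbours x₁ x₂ v₁ v₂
  two-common-neighbours {x₁} {x₂} x₁≢x₂ v₁≢v₂ ¬v₁v₂ N-v₁ N-v₂ = record
    { v₁x₁ = Equivalence.from (N-v₁ x₁) (inj₁ refl) ; v₁x₂ = Equivalence.from (N-v₁ x₂) (inj₂ refl)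
    ; v₂x₁ = Equivalence.from (N-v₂ x₁) (inj₁ refl) ; v₂x₂ = Equivalence.from (N-v₂ x₂) (inj₂ refl)
    ; N-v₁ = pair-∈ ∘ Equivalence.to (N-v₁ _) ; N-v₂ = pair-∈ ∘ Equivalence.to (N-v₂ _)
    ; x₁≢x₂ = x₁≢x₂ ; v₁≢v₂ = v₁≢v₂ ; ¬v₁v₂ = ¬v₁v₂ }
    where
    pair-∈ : ∀ {w} → w ≡ x₁ ⊎ w ≡ x₂ → w ∈ x₁ ∷ x₂ ∷ []
    pair-∈ (inj₁ w≡x₁) = here w≡x₁
    pair-∈ (inj₂ w≡x₂) = there (here w≡x₂)

  TwoCommonNeighbours-swapˣ : ∀ {x₁ x₂ v₁ v₂} →
                              TwoCommonNeighbours x₁ x₂ v₁ v₂ → TwoCommonNeighbours x₂ x₁ v₁ v₂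
  TwoCommonNeighbours-swapˣ c = record
    { v₁x₁ = v₁x₂ ; v₁x₂ = v₁x₁ ; v₂x₁ = v₂x₂ ; v₂x₂ = v₂x₁
    ; N-v₁ = ∈-resp-↭ (swap _ _ ↭-refl) ∘ N-v₁ ; N-v₂ = ∈-resp-↭ (swap _ _ ↭-refl) ∘ N-v₂
    ; x₁≢x₂ = x₁≢x₂ ∘ sym ; v₁≢v₂ = v₁≢v₂ ; ¬v₁v₂ = ¬v₁v₂ }
    where open TwoCommonNeighbours c

  TwoCommonNeighbours-swapᵛ : ∀ {x₁ x₂ v₁ v₂} →
                              TwoCommonNeighbours x₁ x₂ v₁ v₂ → TwoCommonNeighbours x₁ x₂ v₂ v₁
  TwoCommonNeighbours-swapᵛ c = record
    { v₁x₁ = v₂x₁ ; v₁x₂ = v₂x₂ ; v₂x₁ = v₁x₁ ; v₂x₂ = v₁x₂ ; N-v₁ = N-v₂ ; N-v₂ = N-v₁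
    ; x₁≢x₂ = x₁≢x₂ ; v₁≢v₂ = v₁≢v₂ ∘ sym ; ¬v₁v₂ = ¬v₁v₂ ∘ Adj-sym }
    where open TwoCommonNeighbours c

module NewEdge {n : ℕ} (G : Graph n) where
  open Neighbourhoods G

  -- `left ʳ++ u ∷ v ∷ right` is a hamiltonian path of G + uv through the new edge; its vertices
  -- are recorded in the order `left ++ u ∷ v ∷ right`.
  record HamPathVia (u v : Fin n) : Set where
    constructor mkHamPathVia
    field
      left right : List (Fin n)
      left-path  : Linked (Adj G) (u ∷ left)
      right-path : Linked (Adj G) (v ∷ right)
      unique     : Unique (left ++ u ∷ v ∷ right)
      complete   : ∀ w → w ∈ left ++ u ∷ v ∷ right

    sides-unique : Unique ((u ∷ left) ++ v ∷ right)
    sides-unique = Unique-resp-↭ (shift u left (v ∷ right)) unique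

    left-unique : Unique (u ∷ left)
    left-unique = Unique-++⁻ˡ (u ∷ left) sides-unique

    right-unique : Unique (v ∷ right)
    right-unique = Unique-++⁻ʳ (u ∷ left) sides-unique

    sides-disjoint : ∀ {w} → w ∈ u ∷ left → w ∉ v ∷ right
    sides-disjoint = Unique-++⇒∉ʳ (u ∷ left) sides-unique

  open HamPathVia public using (left; right; left-unique; right-unique; sides-disjoint)

  reroute : ∀ {u v} (h : HamPathVia u v) {Q} →
            Q ↭ left h ++ u ∷ v ∷ right h → Linked (Adj G) Q → Traceable G
  reroute h σ Q-path =
    _ , Q-path , Unique-resp-↭ (↭-sym σ) (HamPathVia.unique h)
      , ∈-resp-↭ (↭-sym σ) ∘ HamPathVia.complete h

  HamPathVia-sym : ∀ {u v} → HamPathVia u v → HamPathVia v u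
  HamPathVia-sym {u} {v} (mkHamPathVia L R L-path R-path L++u∷v∷R! complete) =
    mkHamPathVia R L R-path L-path (Unique-resp-↭ σ L++u∷v∷R!) (∈-resp-↭ σ ∘ complete)
    where
    σ : L ++ u ∷ v ∷ R ↭ R ++ v ∷ u ∷ L
    σ = solve 4 (λ L u v R → (L ⊕ u ⊕ v ⊕ R) ⊜ (R ⊕ v ⊕ u ⊕ L)) ↭-refl L [ u ] [ v ] R

  reroute-ʳ++ : ∀ {u v} (h : HamPathVia u v) {a Z M} →
                Z ++ a ∷ M ↭ left h ++ u ∷ v ∷ right h →
                Linked (Adj G) (a ∷ Z) → Linked (Adj G) (a ∷ M) → Traceable G
  reroute-ʳ++ h {a} {Z} {M} σ Z-path M-path =
    reroute h (↭-trans (ʳ++↭++ Z (a ∷ M)) σ) (Linked-ʳ++⁺ Adj-sym Z Z-path M-path)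

  reroute-after-left : ∀ {u v} (h : HamPathVia u v) {M} →
                       M ↭ v ∷ right h → Linked (Adj G) (u ∷ M) → Traceable G
  reroute-after-left h σ = reroute-ʳ++ h (++⁺ˡ (left h) (prep _ σ)) (HamPathVia.left-path h)

  locate : ∀ {u v} (h : HamPathVia u v) {w} → w ≢ u → w ≢ v →
           w ∈ left h ⊎ w ∈ right h
  locate h {w} w≢u w≢v with ∈-++⁻ (left h) (HamPathVia.complete h w)
  ... | inj₁ w∈left                  = inj₁ w∈left
  ... | inj₂ (here w≡u)              = ⊥-elim (w≢u w≡u)
  ... | inj₂ (there (here w≡v))      = ⊥-elim (w≢v w≡v)
  ... | inj₂ (there (there w∈right)) = inj₂ w∈right

  AdjPlus-sym : ∀ {u v a b} → AdjPlus G u v a b → AdjPlus G u v b a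
  AdjPlus-sym (inj₁ ab)                 = inj₁ (Adj-sym ab)
  AdjPlus-sym (inj₂ (inj₁ (a≡u , b≡v))) = inj₂ (inj₂ (b≡v , a≡u))
  AdjPlus-sym (inj₂ (inj₂ (a≡v , b≡u))) = inj₂ (inj₁ (b≡u , a≡v))

  AdjPlus-swap : ∀ {u v a b} → AdjPlus G u v a b → AdjPlus G v u a b
  AdjPlus-swap (inj₁ ab)       = inj₁ ab
  AdjPlus-swap (inj₂ (inj₁ e)) = inj₂ (inj₂ e)
  AdjPlus-swap (inj₂ (inj₂ e)) = inj₂ (inj₁ e)

  Linked-AdjPlus⇒Linked : ∀ {u v xs} → u ∉ xs ⊎ v ∉ xs →
                          Linked (AdjPlus G u v) xs → Linked (Adj G) xs
  Linked-AdjPlus⇒Linked _ [] = []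
  Linked-AdjPlus⇒Linked _ [-] = [-]
  Linked-AdjPlus⇒Linked u∉⊎v∉ (inj₁ ab ∷ rs) =
    ab ∷ Linked-AdjPlus⇒Linked (Data.Sum.map (_∘ there) (_∘ there) u∉⊎v∉) rs
  Linked-AdjPlus⇒Linked (inj₁ u∉) (inj₂ (inj₁ (refl , refl)) ∷ _) = ⊥-elim (u∉ (here refl))
  Linked-AdjPlus⇒Linked (inj₂ v∉) (inj₂ (inj₁ (refl , refl)) ∷ _) = ⊥-elim (v∉ (there (here refl)))
  Linked-AdjPlus⇒Linked (inj₁ u∉) (inj₂ (inj₂ (refl , refl)) ∷ _) = ⊥-elim (u∉ (there (here refl)))
  Linked-AdjPlus⇒Linked (inj₂ v∉) (inj₂ (inj₂ (refl , refl)) ∷ _) = ⊥-elim (v∉ (here refl))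

  Linked-AdjPlus-split : ∀ {u v p} → Linked (AdjPlus G u v) p →
                         Linked (Adj G) p ⊎ ∃₂ λ L R → p ≡ L ++ u ∷ v ∷ R ⊎ p ≡ L ++ v ∷ u ∷ R
  Linked-AdjPlus-split [] = inj₁ []
  Linked-AdjPlus-split [-] = inj₁ [-]
  Linked-AdjPlus-split (inj₂ (inj₁ (refl , refl)) ∷ _) = inj₂ ([] , _ , inj₁ refl)
  Linked-AdjPlus-split (inj₂ (inj₂ (refl , refl)) ∷ _) = inj₂ ([] , _ , inj₂ refl)
  Linked-AdjPlus-split {p = a ∷ _} (inj₁ ab ∷ rs) with Linked-AdjPlus-split rs
  ... | inj₁ rs′               = inj₁ (ab ∷ rs′)
  ... | inj₂ (L , R , inj₁ p≡) = inj₂ (a ∷ L , R , inj₁ (cong (a ∷_) p≡))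
  ... | inj₂ (L , R , inj₂ p≡) = inj₂ (a ∷ L , R , inj₂ (cong (a ∷_) p≡))

  private
    hamPathVia-++ : ∀ {u v} L R → Linked (AdjPlus G u v) (L ++ u ∷ v ∷ R) → Unique (L ++ u ∷ v ∷ R) →
                    (∀ w → w ∈ L ++ u ∷ v ∷ R) → HamPathVia u v
    hamPathVia-++ {u} {v} L R path L++u∷v∷R! complete =
      mkHamPathVia (reverse L) R (Linked-AdjPlus⇒Linked (inj₂ v∉) (proj₁ split))
                   (Linked-AdjPlus⇒Linked (inj₁ u∉) (Linked.tail (proj₂ split)))
                   (Unique-resp-↭ σ L++u∷v∷R!) (∈-resp-↭ σ ∘ complete)
      where
      σ : L ++ u ∷ v ∷ R ↭ reverse L ++ u ∷ v ∷ R
      σ = ++⁺ʳ _ (↭-sym (↭-reverse L))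
      split : Linked (AdjPlus G u v) (u ∷ reverse L) × Linked (AdjPlus G u v) (u ∷ v ∷ R)
      split = Linked-ʳ++⁻ AdjPlus-sym (reverse L) (subst (Linked _) (sym (reverse-ʳ++ L)) path)
      v∉ : v ∉ u ∷ reverse L
      v∉ = proj₁ (Unique-++-∷-∷⇒∉ (reverse L) (Unique-resp-↭ σ L++u∷v∷R!))
      u∉ : u ∉ v ∷ R
      u∉ = proj₂ (Unique-++-∷-∷⇒∉ (reverse L) (Unique-resp-↭ σ L++u∷v∷R!))

  hamPathVia : ∀ {u v} → MaximalNontraceable G → u ≢ v → ¬ Adj G u v → HamPathVia u v
  hamPathVia (nontraceable , traceable-plus) u≢v ¬uv with traceable-plus _ _ u≢v ¬uv
  ... | p , path , p! , complete with Linked-AdjPlus-split path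
  ...   | inj₁ G-path              = ⊥-elim (nontraceable (p , G-path , p! , complete))
  ...   | inj₂ (L , R , inj₁ refl) = hamPathVia-++ L R path p! complete
  ...   | inj₂ (L , R , inj₂ refl) =
    HamPathVia-sym (hamPathVia-++ L R (Linked.map AdjPlus-swap path) p! complete)

module Maximal {n : ℕ} {G : Graph n} (mnt : MaximalNontraceable G) where
  open Neighbourhoods G
  open NewEdge G

  nontraceable : ¬ Traceable G
  nontraceable = proj₁ mnt

  private
    degree-two-in-left : ∀ {p q v} (h : HamPathVia p q) → v ∈ left h →
                         Adj G v p → Adj G v q → N[ v ]⊆ (p ∷ q ∷ []) → ⊥
    degree-two-in-left {p} {q} {v} h@(mkHamPathVia left _ left-path right-path _ _) v∈left vp vq N-v
      with pendant-of-head Adj-sym left left-path (left-unique h) v∈left only-p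
      where
      only-p : ∀ {w} → Adj G v w → w ∈ p ∷ left → w ≡ p
      only-p vw w∈ with N-v vw
      ... | here w≡p          = w≡p
      ... | there (here refl) = ⊥-elim (sides-disjoint h w∈ (here refl))
    ... | refl = nontraceable (reroute h (swap p v ↭-refl) (Adj-sym vp ∷ vq ∷ right-path))

  degree-two-neighbours-adjacent : ∀ {v p q} → p ≢ q → Adj G v p → Adj G v q →
                                   N[ v ]⊆ (p ∷ q ∷ []) → Adj G p q
  degree-two-neighbours-adjacent {v} {p} {q} p≢q vp vq N-v with adj G p q in pq
  ... | true  = refl
  ... | false with hamPathVia mnt p≢q (not-¬ pq)
  ...   | h with locate h (Adj⇒≢ vp) (Adj⇒≢ vq)
  ...     | inj₁ v∈left  = ⊥-elim (degree-two-in-left h v∈left vp vq N-v)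
  ...     | inj₂ v∈right = ⊥-elim (degree-two-in-left (HamPathVia-sym h) v∈right vq vp
                                     (∈-resp-↭ (swap p q ↭-refl) ∘ N-v))

  private
    module _ {x v₁ a v₂ b : Fin n} (c : OneCommonNeighbour x v₁ a v₂ b)
             (N-x : N[ x ]⊆ (v₁ ∷ v₂ ∷ a ∷ b ∷ [])) where
      open OneCommonNeighbour c

      a∉v₁v₂ : ∀ {xs} → a ∈ v₁ ∷ v₂ ∷ xs → a ∈ xs
      a∉v₁v₂ (here a≡v₁)         = ⊥-elim (Adj⇒≢ v₁a (sym a≡v₁))
      a∉v₁v₂ (there (here a≡v₂)) = ⊥-elim (¬v₁v₂ (subst (Adj G v₁) a≡v₂ v₁a))
      a∉v₁v₂ (there (there a∈))  = a∈

      starts-v₁v₂x : ∀ R′ (h : HamPathVia v₁ v₂) →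
                     left h ≡ [] → right h ≡ x ∷ R′ → ⊥
      starts-v₁v₂x [] (mkHamPathVia [] _ _ _ _ complete) refl refl with a∉v₁v₂ (complete a)
      ... | here a≡x = a≢x a≡x
      ... | there ()
      starts-v₁v₂x (s ∷ R″) h@(mkHamPathVia [] _ _ (_ ∷ x-s ∷ s-path) v₁v₂xsR″! _) refl refl
        with N-x x-s
      ... | here refl                         = Unique-++-∷⇒∉ [] v₁v₂xsR″! (there (there (here refl)))
      ... | there (here refl)                 = Unique-++-∷⇒∉ [ v₁ ] v₁v₂xsR″! (there (here refl))
      ... | there (there (here refl))         =
        nontraceable (reroute h (shift v₁ (v₂ ∷ x ∷ []) (a ∷ R″)) (v₂x ∷ Adj-sym v₁x ∷ v₁a ∷ s-path))
      ... | there (there (there (here refl))) =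
        nontraceable (reroute h (prep v₁ (swap x v₂ ↭-refl)) (v₁x ∷ Adj-sym v₂x ∷ v₂b ∷ s-path))
      ... | there (there (there (there ())))

      starts-v₁v₂b : ∀ R′ (h : HamPathVia v₁ v₂) →
                     left h ≡ [] → right h ≡ b ∷ R′ → x ∈ R′ → ⊥
      starts-v₁v₂b R′ h@(mkHamPathVia [] _ _ (_ ∷ R′-path) v₁v₂bR′! complete) refl refl x∈R′
        with position Adj-sym R′ R′-path (Unique-++⁻ʳ (v₁ ∷ v₂ ∷ []) v₁v₂bR′!) x∈R′ N-x-after-b
        where
        N-x-after-b : ∀ {w} → Adj G x w → w ∈ b ∷ R′ → w ∈ b ∷ a ∷ []
        N-x-after-b xw w∈ with N-x xw
        ... | here refl                         = ⊥-elim (Unique-++-∷⇒∉ [] v₁v₂bR′! (there w∈))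
        ... | there (here refl)                 = ⊥-elim (Unique-++-∷⇒∉ [ v₁ ] v₁v₂bR′! w∈)
        ... | there (there (here refl))         = there (here refl)
        ... | there (there (there (here refl))) = here refl
      ... | alone refl with a∉v₁v₂ (complete a)
      ...   | here a≡b         = a≢b a≡b
      ...   | there (here a≡x) = a≢x a≡x
      ...   | there (there ())
      starts-v₁v₂b R′ h@(mkHamPathVia [] _ _ (_ ∷ R′-path) _ _) refl refl _ | first T refl =
        nontraceable (reroute h σ
          (Adj-sym v₂b ∷ v₂x ∷ Adj-sym v₁x ∷ v₁a ∷ Linked.tail (Linked.tail R′-path)))
        where
        σ : b ∷ v₂ ∷ x ∷ v₁ ∷ a ∷ T ↭ v₁ ∷ v₂ ∷ b ∷ x ∷ a ∷ T
        σ = solve 6 (λ b v₂ x v₁ a T → (b ⊕ v₂ ⊕ x ⊕ v₁ ⊕ a ⊕ T) ⊜ (v₁ ⊕ v₂ ⊕ b ⊕ x ⊕ a ⊕ T))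
                    ↭-refl [ b ] [ v₂ ] [ x ] [ v₁ ] [ a ] T
      starts-v₁v₂b R′ h@(mkHamPathVia [] _ _ (_ ∷ R′-path) _ _) refl refl _ | last T refl =
        nontraceable (reroute h σ
          (Linked-graft (b ∷ T) R′-path (Adj-sym v₁a ∷ v₁x ∷ Adj-sym v₂x ∷ [-])))
        where
        σ : (b ∷ T) ++ a ∷ v₁ ∷ x ∷ v₂ ∷ [] ↭ v₁ ∷ v₂ ∷ b ∷ T ++ a ∷ x ∷ []
        σ = solve 6 (λ b T a v₁ x v₂ → (b ⊕ T ⊕ a ⊕ v₁ ⊕ x ⊕ v₂) ⊜ (v₁ ⊕ v₂ ⊕ b ⊕ T ⊕ a ⊕ x))
                    ↭-refl [ b ] T [ a ] [ v₁ ] [ x ] [ v₂ ]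

      common-neighbour-in-right : (h : HamPathVia v₁ v₂) → x ∈ right h → ⊥
      common-neighbour-in-right h@(mkHamPathVia [] (r ∷ R′) _ (v₂r ∷ _) _ _) x∈ with N-v₂ v₂r | x∈
      ... | here refl         | _           = starts-v₁v₂x R′ h refl refl
      ... | there (here refl) | here x≡b    = b≢x (sym x≡b)
      ... | there (here refl) | there x∈R′ = starts-v₁v₂b R′ h refl refl x∈R′
      common-neighbour-in-right h@(mkHamPathVia (y ∷ Z′) R (v₁y ∷ _) R-path _ _) x∈R with N-v₁ v₁y
      ... | here refl = sides-disjoint h (there (here refl)) (there x∈R)
      ... | there (here refl)
        with position Adj-sym R R-path (right-unique h) x∈R N-x-right
        where
        N-x-right : ∀ {w} → Adj G x w → w ∈ v₂ ∷ R → w ∈ v₂ ∷ b ∷ []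
        N-x-right xw w∈ with N-x xw
        ... | here refl                         = ⊥-elim (sides-disjoint h (here refl) w∈)
        ... | there (here refl)                 = here refl
        ... | there (there (here refl))         = ⊥-elim (sides-disjoint h (there (here refl)) w∈)
        ... | there (there (there (here refl))) = there (here refl)
      ...   | alone refl   = nontraceable (reroute-after-left h (swap x v₂ ↭-refl) (v₁x ∷ Adj-sym v₂x ∷ [-]))
      ...   | first T refl = nontraceable (reroute-after-left h (swap x v₂ ↭-refl)
                               (v₁x ∷ Adj-sym v₂x ∷ v₂b ∷ Linked.tail (Linked.tail R-path)))
      ...   | last [] refl = nontraceable (reroute-after-left h
                               (↭-trans (swap x v₂ ↭-refl) (prep v₂ (swap x b ↭-refl)))
                               (v₁x ∷ Adj-sym v₂x ∷ v₂b ∷ [-]))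
      ...   | last (t ∷ T) refl with N-v₂ (Linked.head R-path)
      ...     | here refl         = Unique-++-∷⇒∉ [ v₂ ] (right-unique h) (∈-++⁺ʳ T (there (here refl)))
      ...     | there (here refl) = Unique-++-∷⇒∉ [ v₂ ] (right-unique h) (∈-++⁺ʳ T (here refl))

  common-neighbour-not-⊆ : ∀ {x v₁ a v₂ b} → OneCommonNeighbour x v₁ a v₂ b →
                           ¬ N[ x ]⊆ (v₁ ∷ v₂ ∷ a ∷ b ∷ [])
  common-neighbour-not-⊆ {x} {v₁} {a} {v₂} {b} c N-x =
    [ common-neighbour-in-right (OneCommonNeighbour-sym c) (∈-resp-↭ σ ∘ N-x) (HamPathVia-sym h)
    , common-neighbour-in-right c N-x h
    ]′ (locate h (Adj⇒≢ v₁x ∘ sym) (Adj⇒≢ v₂x ∘ sym))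
    where
    open OneCommonNeighbour c
    h : HamPathVia v₁ v₂
    h = hamPathVia mnt v₁≢v₂ ¬v₁v₂
    σ : v₁ ∷ v₂ ∷ a ∷ b ∷ [] ↭ v₂ ∷ v₁ ∷ b ∷ a ∷ []
    σ = swap v₁ v₂ (swap a b ↭-refl)

  private
    module _ {x₁ x₂ w : Fin n} (x₁w : Adj G x₁ w) where

      ends-x₁-v : ∀ {v} (h : HamPathVia w x₂) → N[ v ]≡[ x₁ , x₂ ] → v ∈ left h →
                  ∃ λ T → left h ≡ T ++ x₁ ∷ v ∷ []
      ends-x₁-v {v} h (_ , _ , N-v) v∈left
        with pendant-last Adj-sym _ (HamPathVia.left-path h) (left-unique h) v∈left only-x₁
        where
        only-x₁ : ∀ {u} → Adj G v u → u ∈ w ∷ left h → u ≡ x₁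
        only-x₁ vu u∈ with N-v vu
        ... | here u≡x₁         = u≡x₁
        ... | there (here refl) = ⊥-elim (sides-disjoint h u∈ (here refl))
      ... | inj₁ ends-with-x₁v = ends-with-x₁v
      ... | inj₂ (_ , w≡x₁)    = ⊥-elim (Adj⇒≢ x₁w (sym w≡x₁))

      position-in-right : ∀ {v} (h : HamPathVia w x₂) → N[ v ]≡[ x₁ , x₂ ] → v ∈ right h →
                          Position x₁ v (right h)
      position-in-right h (_ , _ , N-v) v∈right =
        position Adj-sym _ (HamPathVia.right-path h) (right-unique h) v∈right
                 (λ vu _ → ∈-resp-↭ (swap x₁ x₂ ↭-refl) (N-v vu))

      one-on-each-side : ∀ {va vb} (h : HamPathVia w x₂) → N[ va ]≡[ x₁ , x₂ ] → N[ vb ]≡[ x₁ , x₂ ] →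
                         (∃ λ T → left h ≡ T ++ x₁ ∷ va ∷ []) →
                         Position x₁ vb (right h) → ⊥
      one-on-each-side {va} {vb} h@(mkHamPathVia _ _ left-path _ _ _) (_ , vax₂ , _) (vbx₁ , vbx₂ , _)
                             (T , refl) (alone refl) =
        nontraceable (reroute h σ (vax₂ ∷ Adj-sym vbx₂ ∷ vbx₁ ∷ x₁w ∷ Linked-++⁻ˡ (w ∷ T) left-path))
        where
        σ : va ∷ x₂ ∷ vb ∷ x₁ ∷ w ∷ T ↭ (T ++ x₁ ∷ va ∷ []) ++ w ∷ x₂ ∷ vb ∷ []
        σ = solve 6 (λ T x₁ w va vb x₂ → (va ⊕ x₂ ⊕ vb ⊕ x₁ ⊕ w ⊕ T) ⊜ ((T ⊕ x₁ ⊕ va) ⊕ w ⊕ x₂ ⊕ vb))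
                    ↭-refl T [ x₁ ] [ w ] [ va ] [ vb ] [ x₂ ]
      one-on-each-side h@(mkHamPathVia _ _ _ _ _ _) _ _ (T , refl) (first _ refl) =
        sides-disjoint h (there (∈-++⁺ʳ T (here refl))) (there (there (here refl)))
      one-on-each-side h@(mkHamPathVia _ _ _ _ _ _) _ _ (T , refl) (last T′ refl) =
        sides-disjoint h (there (∈-++⁺ʳ T (here refl))) (there (∈-++⁺ʳ T′ (here refl)))

      x₁-between-on-right : ∀ {va vb} (h : HamPathVia w x₂) → N[ va ]≡[ x₁ , x₂ ] → N[ vb ]≡[ x₁ , x₂ ] →
                            right h ≡ va ∷ x₁ ∷ vb ∷ [] → ⊥
      x₁-between-on-right {va} {vb} h@(mkHamPathVia _ _ _ _ _ _) (vax₁ , vax₂ , _) (_ , vbx₂ , _) refl =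
        nontraceable (reroute-after-left h σ (Adj-sym x₁w ∷ Adj-sym vax₁ ∷ vax₂ ∷ Adj-sym vbx₂ ∷ [-]))
        where
        σ : x₁ ∷ va ∷ x₂ ∷ vb ∷ [] ↭ x₂ ∷ va ∷ x₁ ∷ vb ∷ []
        σ = solve 4 (λ x₁ va x₂ vb → (x₁ ⊕ va ⊕ x₂ ⊕ vb) ⊜ (x₂ ⊕ va ⊕ x₁ ⊕ vb)) ↭-refl [ x₁ ] [ va ] [ x₂ ] [ vb ]

      no-path-through-wx₂ : ∀ {v₁ v₂} (h : HamPathVia w x₂) → ¬ Adj G w x₂ →
                            N[ v₁ ]≡[ x₁ , x₂ ] → N[ v₂ ]≡[ x₁ , x₂ ] → v₁ ≢ v₂ → ⊥
      no-path-through-wx₂ {v₁} {v₂} h ¬wx₂ N-v₁ N-v₂ v₁≢v₂ = on-sides (side N-v₁) (side N-v₂)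
        where
        side : ∀ {v} → N[ v ]≡[ x₁ , x₂ ] → v ∈ left h ⊎ v ∈ right h
        side (_ , vx₂ , _) = locate h (λ v≡w → ¬wx₂ (subst (λ u → Adj G u x₂) v≡w vx₂)) (Adj⇒≢ vx₂)

        on-sides : v₁ ∈ left h ⊎ v₁ ∈ right h → v₂ ∈ left h ⊎ v₂ ∈ right h → ⊥
        on-sides (inj₁ v₁∈) (inj₁ v₂∈) with ends-x₁-v h N-v₁ v₁∈ | ends-x₁-v h N-v₂ v₂∈
        ... | T₁ , e₁ | T₂ , e₂ = v₁≢v₂ (++-∷-∷-injectiveʳ T₁ T₂ (trans (sym e₁) e₂))
        on-sides (inj₁ v₁∈) (inj₂ v₂∈) =
          one-on-each-side h N-v₁ N-v₂ (ends-x₁-v h N-v₁ v₁∈) (position-in-right h N-v₂ v₂∈)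
        on-sides (inj₂ v₁∈) (inj₁ v₂∈) =
          one-on-each-side h N-v₂ N-v₁ (ends-x₁-v h N-v₂ v₂∈) (position-in-right h N-v₁ v₁∈)
        on-sides (inj₂ v₁∈) (inj₂ v₂∈)
          with Position-pair (Unique-++⁻ʳ [ x₂ ] (right-unique h)) v₁≢v₂
                             (position-in-right h N-v₁ v₁∈) (position-in-right h N-v₂ v₂∈)
        ... | inj₁ e = x₁-between-on-right h N-v₁ N-v₂ e
        ... | inj₂ e = x₁-between-on-right h N-v₂ N-v₁ e

  twin-neighbour : ∀ {x₁ x₂ v₁ v₂} → TwoCommonNeighbours x₁ x₂ v₁ v₂ →
                   ∀ {w} → Adj G x₁ w → w ≢ x₂ → Adj G x₂ w
  twin-neighbour {x₂ = x₂} c {w} x₁w w≢x₂ with adj G x₂ w in x₂w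
  ... | true  = refl
  ... | false =
    ⊥-elim (no-path-through-wx₂ x₁w (hamPathVia mnt w≢x₂ ¬wx₂) ¬wx₂ N-v₁≡ N-v₂≡ v₁≢v₂)
    where
    open TwoCommonNeighbours c
    ¬wx₂ : ¬ Adj G w x₂
    ¬wx₂ = not-¬ x₂w ∘ Adj-sym

  private
    module _ {x₁ x₂ v₁ v₂ y : Fin n} (c : TwoCommonNeighbours x₁ x₂ v₁ v₂)
             (N-x₁ : N[ x₁ ]⊆ (y ∷ x₂ ∷ v₁ ∷ v₂ ∷ [])) (N-x₂ : N[ x₂ ]⊆ (y ∷ x₁ ∷ v₁ ∷ v₂ ∷ [])) where
      open TwoCommonNeighbours c

      ends-x₁v₁v₂ : ∀ Z′ (h : HamPathVia v₁ v₂) → left h ≡ x₁ ∷ Z′ → right h ≡ [] → ⊥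
      ends-x₁v₁v₂ [] (mkHamPathVia _ _ _ _ _ complete) refl refl with complete x₂
      ... | here x₂≡x₁                 = x₁≢x₂ (sym x₂≡x₁)
      ... | there (here x₂≡v₁)         = Adj⇒≢ v₁x₂ (sym x₂≡v₁)
      ... | there (there (here x₂≡v₂)) = Adj⇒≢ v₂x₂ (sym x₂≡v₂)
      ends-x₁v₁v₂ (γ ∷ Z″) h@(mkHamPathVia _ _ (_ ∷ x₁γ ∷ γ-path) _ x₁γZ″v₁v₂! _) refl refl
        with γ ≟ x₂
      ... | yes refl = nontraceable (reroute-ʳ++ h σ γ-path (Adj-sym v₁x₂ ∷ v₁x₁ ∷ Adj-sym v₂x₁ ∷ [-]))
        where
        σ : Z″ ++ x₂ ∷ v₁ ∷ x₁ ∷ v₂ ∷ [] ↭ x₁ ∷ x₂ ∷ Z″ ++ v₁ ∷ v₂ ∷ []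
        σ = solve 5 (λ Z″ x₁ x₂ v₁ v₂ → (Z″ ⊕ x₂ ⊕ v₁ ⊕ x₁ ⊕ v₂) ⊜ (x₁ ⊕ x₂ ⊕ Z″ ⊕ v₁ ⊕ v₂))
                    ↭-refl Z″ [ x₁ ] [ x₂ ] [ v₁ ] [ v₂ ]
      ... | no γ≢x₂ with N-x₁ x₁γ
      ...   | there (here γ≡x₂)                 = γ≢x₂ γ≡x₂
      ...   | there (there (here refl))         =
        Unique-++⇒∉ʳ (x₁ ∷ v₁ ∷ Z″) x₁γZ″v₁v₂! (there (here refl)) (here refl)
      ...   | there (there (there (here refl))) =
        Unique-++⇒∉ʳ (x₁ ∷ v₂ ∷ Z″) x₁γZ″v₁v₂! (there (here refl)) (there (here refl))
      ...   | here refl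
        with pendant-of-head Adj-sym Z″ γ-path (Unique-++⁻ʳ (v₁ ∷ x₁ ∷ []) (left-unique h)) x₂∈Z″ only-y
        where
        x₂∈Z″ : x₂ ∈ Z″
        x₂∈Z″ with locate h (Adj⇒≢ v₁x₂ ∘ sym) (Adj⇒≢ v₂x₂ ∘ sym)
        ... | inj₁ (here x₂≡x₁)        = ⊥-elim (x₁≢x₂ (sym x₂≡x₁))
        ... | inj₁ (there (here x₂≡y)) = ⊥-elim (γ≢x₂ (sym x₂≡y))
        ... | inj₁ (there (there x₂∈)) = x₂∈
        only-y : ∀ {u} → Adj G x₂ u → u ∈ y ∷ Z″ → u ≡ y
        only-y x₂u u∈ with N-x₂ x₂u
        ... | here u≡y                          = u≡y
        ... | there (here refl)                 = ⊥-elim (Unique-++-∷⇒∉ [ v₁ ] (left-unique h) u∈)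
        ... | there (there (here refl))         = ⊥-elim (Unique-++-∷⇒∉ [] (left-unique h) (there u∈))
        ... | there (there (there (here refl))) = ⊥-elim (sides-disjoint h (there (there u∈)) (here refl))
      ...     | refl = nontraceable (reroute h (shift x₁ (y ∷ x₂ ∷ v₁ ∷ []) (v₂ ∷ []))
                                       (Linked.head γ-path ∷ Adj-sym v₁x₂ ∷ v₁x₁ ∷ Adj-sym v₂x₁ ∷ [-]))

      through-x₁v₁v₂x₂ : ∀ Z′ R′ (h : HamPathVia v₁ v₂) →
                         left h ≡ x₁ ∷ Z′ → right h ≡ x₂ ∷ R′ → ⊥
      through-x₁v₁v₂x₂ [] R′ h@(mkHamPathVia _ _ _ right-path _ _) refl refl =
        nontraceable (reroute h (swap v₁ x₁ ↭-refl) (v₁x₁ ∷ Adj-sym v₂x₁ ∷ right-path))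
      through-x₁v₁v₂x₂ Z′ [] h@(mkHamPathVia _ _ (_ ∷ Z′-path) _ _ _) refl refl =
        nontraceable (reroute-ʳ++ h σ Z′-path (Adj-sym v₂x₁ ∷ v₂x₂ ∷ Adj-sym v₁x₂ ∷ [-]))
        where
        σ : Z′ ++ x₁ ∷ v₂ ∷ x₂ ∷ v₁ ∷ [] ↭ x₁ ∷ Z′ ++ v₁ ∷ v₂ ∷ x₂ ∷ []
        σ = solve 5 (λ Z′ x₁ x₂ v₁ v₂ → (Z′ ⊕ x₁ ⊕ v₂ ⊕ x₂ ⊕ v₁) ⊜ (x₁ ⊕ Z′ ⊕ v₁ ⊕ v₂ ⊕ x₂))
                    ↭-refl Z′ [ x₁ ] [ x₂ ] [ v₁ ] [ v₂ ]
      through-x₁v₁v₂x₂ (γ ∷ Z″) (δ ∷ R″) h@(mkHamPathVia _ _ (_ ∷ x₁γ ∷ _) (_ ∷ x₂δ ∷ _) _ _) refl refl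
        with N-x₁ x₁γ
      ... | there (here refl)                 = sides-disjoint h (there (there (here refl))) (there (here refl))
      ... | there (there (here refl))         = Unique-++-∷⇒∉ [] (left-unique h) (there (here refl))
      ... | there (there (there (here refl))) = sides-disjoint h (there (there (here refl))) (here refl)
      ... | here refl with N-x₂ x₂δ
      ...   | here refl                         = sides-disjoint h (there (there (here refl))) (there (there (here refl)))
      ...   | there (here refl)                 = sides-disjoint h (there (here refl)) (there (there (here refl)))
      ...   | there (there (here refl))         = sides-disjoint h (here refl) (there (there (here refl)))
      ...   | there (there (there (here refl))) = Unique-++-∷⇒∉ [] (right-unique h) (there (here refl))

  twins-not-⊆ : ∀ {x₁ x₂ v₁ v₂ y} → TwoCommonNeighbours x₁ x₂ v₁ v₂ →
                N[ x₁ ]⊆ (y ∷ x₂ ∷ v₁ ∷ v₂ ∷ []) → ¬ N[ x₂ ]⊆ (y ∷ x₁ ∷ v₁ ∷ v₂ ∷ [])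
  twins-not-⊆ {x₁} {x₂} {v₁} {v₂} {y} c N-x₁ N-x₂ = on-path (hamPathVia mnt v₁≢v₂ ¬v₁v₂)
    where
    open TwoCommonNeighbours c
    cˣ : TwoCommonNeighbours x₂ x₁ v₁ v₂
    cˣ = TwoCommonNeighbours-swapˣ c
    cᵛ : TwoCommonNeighbours x₁ x₂ v₂ v₁
    cᵛ = TwoCommonNeighbours-swapᵛ c
    σ : ∀ {x} → y ∷ x ∷ v₁ ∷ v₂ ∷ [] ↭ y ∷ x ∷ v₂ ∷ v₁ ∷ []
    σ = prep y (prep _ (swap v₁ v₂ ↭-refl))

    on-path : HamPathVia v₁ v₂ → ⊥
    on-path (mkHamPathVia [] [] _ _ _ complete) with complete x₁
    ... | here x₁≡v₁         = Adj⇒≢ v₁x₁ (sym x₁≡v₁)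
    ... | there (here x₁≡v₂) = Adj⇒≢ v₂x₁ (sym x₁≡v₂)
    on-path h@(mkHamPathVia (α ∷ Z′) [] (v₁α ∷ _) _ _ _) with N-v₁ v₁α
    ... | here refl         = ends-x₁v₁v₂ c N-x₁ N-x₂ Z′ h refl refl
    ... | there (here refl) = ends-x₁v₁v₂ cˣ N-x₂ N-x₁ Z′ h refl refl
    on-path h@(mkHamPathVia [] (β ∷ R′) _ (v₂β ∷ _) _ _) with N-v₂ v₂β
    ... | here refl         =
      ends-x₁v₁v₂ cᵛ (∈-resp-↭ σ ∘ N-x₁) (∈-resp-↭ σ ∘ N-x₂) R′ (HamPathVia-sym h) refl refl
    ... | there (here refl) =
      ends-x₁v₁v₂ (TwoCommonNeighbours-swapˣ cᵛ) (∈-resp-↭ σ ∘ N-x₂) (∈-resp-↭ σ ∘ N-x₁)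
                  R′ (HamPathVia-sym h) refl refl
    on-path h@(mkHamPathVia (α ∷ Z′) (β ∷ R′) (v₁α ∷ _) (v₂β ∷ _) _ _) with N-v₁ v₁α | N-v₂ v₂β
    ... | here refl         | here refl         = sides-disjoint h (there (here refl)) (there (here refl))
    ... | there (here refl) | there (here refl) = sides-disjoint h (there (here refl)) (there (here refl))
    ... | here refl         | there (here refl) = through-x₁v₁v₂x₂ c N-x₁ N-x₂ Z′ R′ h refl refl
    ... | there (here refl) | here refl         = through-x₁v₁v₂x₂ cˣ N-x₂ N-x₁ Z′ R′ h refl refl

  private
    twin-N⊆ : ∀ {x₁ x₂ v₁ v₂ y} → TwoCommonNeighbours x₁ x₂ v₁ v₂ →
              N[ x₁ ]⊆ (y ∷ x₂ ∷ v₁ ∷ v₂ ∷ []) → N[ x₂ ]⊆ (y ∷ x₁ ∷ v₁ ∷ v₂ ∷ [])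
    twin-N⊆ {x₁} c N-x₁ {u} x₂u with u ≟ x₁
    ... | yes refl = there (here refl)
    ... | no u≢x₁ with N-x₁ (twin-neighbour (TwoCommonNeighbours-swapˣ c) x₂u u≢x₁)
    ...   | here u≡y          = here u≡y
    ...   | there (here refl) = ⊥-elim (Adj⇒≢ x₂u refl)
    ...   | there (there u∈)  = there (there u∈)

  common-neighbour-deg≥5 : ∀ {x v₁ a v₂ b} → OneCommonNeighbour x v₁ a v₂ b → deg G x ≥ 5
  common-neighbour-deg≥5 {x} {v₁} {a} {v₂} {b} c with deg G x ≤? 4
  ... | no  deg≰4 = ≰⇒> deg≰4
  ... | yes deg≤4 =
    ⊥-elim (common-neighbour-not-⊆ c
             (deg≤length⇒N⊆ distinct (Adj-sym v₁x ∷ Adj-sym v₂x ∷ xa ∷ xb ∷ []) deg≤4))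
    where
    open OneCommonNeighbour c
    xa : Adj G x a
    xa = degree-two-neighbours-adjacent (a≢x ∘ sym) v₁x v₁a N-v₁
    xb : Adj G x b
    xb = degree-two-neighbours-adjacent (b≢x ∘ sym) v₂x v₂b N-v₂
    distinct : Unique (v₁ ∷ v₂ ∷ a ∷ b ∷ [])
    distinct = (v₁≢v₂ ∷ Adj⇒≢ v₁a ∷ (λ v₁≡b → ¬v₁v₂ (Adj-sym (subst (Adj G v₂) (sym v₁≡b) v₂b))) ∷ [])
             ∷ ((λ v₂≡a → ¬v₁v₂ (subst (Adj G v₁) (sym v₂≡a) v₁a)) ∷ Adj⇒≢ v₂b ∷ [])
             ∷ (a≢b ∷ []) ∷ [] ∷ []

  twins-adjacent : ∀ {x₁ x₂ v₁ v₂} → TwoCommonNeighbours x₁ x₂ v₁ v₂ → Adj G x₁ x₂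
  twins-adjacent c = degree-two-neighbours-adjacent x₁≢x₂ v₁x₁ v₁x₂ N-v₁
    where open TwoCommonNeighbours c

  twin-neighbourhoods : ∀ {x₁ x₂ v₁ v₂} → TwoCommonNeighbours x₁ x₂ v₁ v₂ →
                        ∀ w → (Adj G x₁ w × w ≢ x₂) ⇔ (Adj G x₂ w × w ≢ x₁)
  twin-neighbourhoods c w = mk⇔
    (λ (x₁w , w≢x₂) → twin-neighbour c x₁w w≢x₂ , Adj⇒≢ x₁w ∘ sym)
    (λ (x₂w , w≢x₁) → twin-neighbour (TwoCommonNeighbours-swapˣ c) x₂w w≢x₁ , Adj⇒≢ x₂w ∘ sym)

  twin-deg≡ : ∀ {x₁ x₂ v₁ v₂} → TwoCommonNeighbours x₁ x₂ v₁ v₂ → deg G x₁ ≡ deg G x₂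
  twin-deg≡ c = ≤-antisym
    (deg≤-of-twin (twins-adjacent c) (twin-neighbour c))
    (deg≤-of-twin (Adj-sym (twins-adjacent c)) (twin-neighbour (TwoCommonNeighbours-swapˣ c)))

  twin-deg≥5 : ∀ {x₁ x₂ v₁ v₂} → TwoCommonNeighbours x₁ x₂ v₁ v₂ → deg G x₁ ≥ 5
  twin-deg≥5 {x₁} {x₂} {v₁} {v₂} c with deg G x₁ ≤? 4
  ... | no  deg≰4 = ≰⇒> deg≰4
  ... | yes deg≤4 =
    let _ , N-x₁ = deg≤1+length⇒N⊆∷ distinct (twins-adjacent c ∷ Adj-sym v₁x₁ ∷ Adj-sym v₂x₁ ∷ []) deg≤4
    in ⊥-elim (twins-not-⊆ c N-x₁ (twin-N⊆ c N-x₁))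
    where
    open TwoCommonNeighbours c
    distinct : Unique (x₂ ∷ v₁ ∷ v₂ ∷ [])
    distinct = (Adj⇒≢ v₁x₂ ∘ sym ∷ Adj⇒≢ v₂x₂ ∘ sym ∷ []) ∷ (v₁≢v₂ ∷ []) ∷ [] ∷ []

lemma6 : ∀ {n : ℕ} (G : Graph n) → Connected G → MaximalNontraceable G →
         ∀ (v₁ v₂ : Fin n) → v₁ ≢ v₂ → ¬ Adj G v₁ v₂ →
         deg G v₁ ≡ 2 → deg G v₂ ≡ 2 →
         (∀ (x : Fin n) →
            (∀ (w : Fin n) → (Adj G v₁ w × Adj G v₂ w) ⇔ (w ≡ x)) →
            deg G x ≥ 5)
         ×
         (∀ (x₁ x₂ : Fin n) → x₁ ≢ x₂ →
            (∀ (w : Fin n) → Adj G v₁ w ⇔ (w ≡ x₁ ⊎ w ≡ x₂)) →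
            (∀ (w : Fin n) → Adj G v₂ w ⇔ (w ≡ x₁ ⊎ w ≡ x₂)) →
            (∀ (w : Fin n) → (Adj G x₁ w × w ≢ x₂) ⇔ (Adj G x₂ w × w ≢ x₁))
            × deg G x₁ ≡ deg G x₂ × deg G x₁ ≥ 5)
lemma6 G _ mnt v₁ v₂ v₁≢v₂ ¬v₁v₂ deg-v₁ deg-v₂ =
    (λ x common → let _ , _ , c = one-common-neighbour deg-v₁ deg-v₂ v₁≢v₂ ¬v₁v₂ common
                  in common-neighbour-deg≥5 c)
  , (λ x₁ x₂ x₁≢x₂ N-v₁ N-v₂ → let c = two-common-neighbours x₁≢x₂ v₁≢v₂ ¬v₁v₂ N-v₁ N-v₂
                               in twin-neighbourhoods c , twin-deg≡ c , twin-deg≥5 c)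
  where
  open Neighbourhoods G
  open Maximal mnt
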